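{- Fix $d\ge 1$ and a step set $\mathcal{S}\subseteq\{ -1,0,1\}^d\setminus\{\mathbf 0\}$ which is symmetric with respect to each axis (i.e. $(i_1,\dots,i_k,\dots,i_d)\in\mathcal{S}$ implies $(i_1,\dots,-i_k,\dots,i_d)\in\mathcal{S}$ for every $k$) and such that for every coordinate $k$ some step of $\mathcal{S}$ has $k$-th coordinate $1$. Let $F(\mathbf z,t)=\sum_{n\ge0}\sum_{\mathbf i\in\mathbb Z^d}s_{\mathbf i}(n)\mathbf z^{\mathbf i}t^n$, where $s_{\mathbf i}(n)$ is the number of walks of length $n$ from the origin with steps in $\mathcal{S}$ that never leave $\mathbb{Z}_{\ge0}^d$ and end at $\mathbf i$, and let $S(\mathbf z)=\sum_{\mathbf i\in\mathcal{S}}\mathbf z^{\mathbf i}$. Let $\mathcal{G}$ be the group of $2^d$ maps $(z_1,\dots,z_d)\mapsto(z_1^{\epsilon_1},\dots,z_d^{\epsilon_d})$, $(\epsilon_1,\dots,\epsilon_d)\in\{ -1,1\}^d$, acting on $\mathbb{Q}[z_1,z_1^{ -1},\dots,z_d,z_d^{ -1}][[t]]$ by $\sigma(A(\mathbf z,t))=A(\sigma(\mathbf z),t)$, and let $\operatorname{sgn}(\sigma)=(-1)^r$ where $r=\#\{k:\sigma(z_k)=z_k^{ -1}\}$. Then, in $\mathbb{Q}[z_1,z_1^{ -1},\dots,z_d,z_d^{ -1}][[t]]$, $$\sum_{\sigma\in\mathcal G}\operatorname{sgn}(\sigma)\,\sigma(z_1\cdots z_d)\,\sigma(F(\mathbf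 z,t))=\frac{\sum_{\sigma\in\mathcal G}\operatorname{sgn}(\sigma)\,\sigma(z_1\cdots z_d)}{1-tS(\mathbf z)}.$$
   Context: $\mathbf z^{\mathbf i}=z_1^{i_1}\cdots z_d^{i_d}$; $1/(1-tS(\mathbf z))$ is expanded as a power series in $t$. -}

module Defs where

open import Data.Bool using (Bool; true; false; if_then_else_; _∧_)
open import Data.Nat using (ℕ; zero; suc)
open import Data.Integer as ℤ using (ℤ; 0ℤ; 1ℤ; -1ℤ; _≤ᵇ_)
open import Data.Integer.Properties using () renaming (_≟_ to _≟ℤ_)
open import Data.Rational as ℚ using (ℚ; 0ℚ; 1ℚ)
open import Data.Fin using (Fin)
open import Data.Vec as Vec using (Vec; []; _∷_; zipWith; replicate; lookup; updateAt)
open import Data.Vec.Properties using (≡-dec)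
open import Data.List as List using (List; []; _∷_; map; concatMap; filterᵇ; foldr; foldl)
open import Data.List.Membership.Propositional using (_∈_)
open import Data.List.Relation.Unary.Unique.Propositional using (Unique)
open import Data.Product using (_×_; _,_; ∃)
open import Data.Sum using (_⊎_)
open import Relation.Nullary using (¬_)
open import Relation.Nullary.Decidable using (does)
open import Relation.Binary.PropositionalEquality using (_≡_)

Pt : ℕ → Set
Pt d = Vec ℤ d

_⊕_ : ∀ {d} → Pt d → Pt d → Pt d
_⊕_ = zipWith ℤ._+_

origin : ∀ d → Pt d
origin d = replicate d 0ℤ

flipAt : ∀ {d} → Fin d → Pt d → Pt d
flipAt k s = updateAt s k (λ x → ℤ.- x)

nonneg : ∀ {d} → Pt d → Bool
nonneg []       = true
nonneg (x ∷ xs) = (0ℤ ≤ᵇ x) ∧ nonneg xs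

record StepSet (d : ℕ) : Set where
  field
    steps      : List (Pt d)
    unique     : Unique steps
    entries    : ∀ {s} → s ∈ steps → ∀ k →
                   (lookup s k ≡ -1ℤ) ⊎ (lookup s k ≡ 0ℤ) ⊎ (lookup s k ≡ 1ℤ)
    nonzero    : ¬ (origin d ∈ steps)
open StepSet public

AxisSymmetric : ∀ {d} → StepSet d → Set
AxisSymmetric {d} S = ∀ {s} → s ∈ steps S → ∀ (k : Fin d) → flipAt k s ∈ steps S

PositiveInEveryDirection : ∀ {d} → StepSet d → Set
PositiveInEveryDirection {d} S = ∀ (k : Fin d) → ∃ λ s → s ∈ steps S × lookup s k ≡ 1ℤ

walksOfLength : ∀ {d} → List (Pt d) → ℕ → List (List (Pt d))
walksOfLength S zero    = [] ∷ []
walksOfLength S (suc n) = concatMap (λ s → map (s ∷_) (walksOfLength S n)) S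

endFrom : ∀ {d} → Pt d → List (Pt d) → Pt d
endFrom p w = foldl _⊕_ p w

-- every point visited after p (p itself assumed checked) lies in ℤ_{≥0}^d
staysFrom : ∀ {d} → Pt d → List (Pt d) → Bool
staysFrom p []       = true
staysFrom p (s ∷ w)  = nonneg (p ⊕ s) ∧ staysFrom (p ⊕ s) w

inOrthant : ∀ {d} → List (Pt d) → Bool
inOrthant {d} w = nonneg (origin d) ∧ staysFrom (origin d) w

-- Laurent polynomials in z₁,…,z_d over ℚ, in sparse form:
-- a list of terms (exponent vector i, coefficient c) meaning Σ c·z^i.

LPoly : ℕ → Set
LPoly d = List (Pt d × ℚ)

coeff : ∀ {d} → LPoly d → Pt d → ℚ
coeff P i = foldr (λ { (e , c) acc → (if does (≡-dec _≟ℤ_ e i) then c else 0ℚ) ℚ.+ acc }) 0ℚ P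

_≈L_ : ∀ {d} → LPoly d → LPoly d → Set
P ≈L Q = ∀ i → coeff P i ≡ coeff Q i

lone : ∀ {d} → LPoly d
lone {d} = (origin d , 1ℚ) ∷ []

_*L_ : ∀ {d} → LPoly d → LPoly d → LPoly d
P *L Q = concatMap (λ { (e , c) → map (λ { (e′ , c′) → (e ⊕ e′ , c ℚ.* c′) }) Q }) P

_^L_ : ∀ {d} → LPoly d → ℕ → LPoly d
P ^L zero  = lone
P ^L suc n = P *L (P ^L n)

scaleL : ∀ {d} → ℚ → LPoly d → LPoly d
scaleL a P = map (λ { (e , c) → (e , a ℚ.* c) }) P

mono : ∀ {d} → Pt d → LPoly d
mono i = (i , 1ℚ) ∷ []

stepPoly : ∀ {d} → StepSet d → LPoly d
stepPoly S = map (λ s → (s , 1ℚ)) (steps S)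

-- [t^n] F(z,t) = Σ_i s_i(n) z^i = Σ over quadrant walks w of length n of z^{end(w)}
Fcoeff : ∀ {d} → StepSet d → ℕ → LPoly d
Fcoeff {d} S n =
  map (λ w → (endFrom (origin d) w , 1ℚ)) (filterᵇ inOrthant (walksOfLength (steps S) n))

-- The group G ≅ {-1,1}^d: an element is a vector of Booleans,
-- true at k meaning σ(z_k) = z_k⁻¹.

Sigma : ℕ → Set
Sigma d = Vec Bool d

allSigma : ∀ d → List (Sigma d)
allSigma zero    = [] ∷ []
allSigma (suc d) = concatMap (λ b → map (b ∷_) (allSigma d)) (true ∷ false ∷ [])

sgn : ∀ {d} → Sigma d → ℚ
sgn []          = 1ℚ
sgn (true ∷ σ)  = ℚ.- sgn σ
sgn (false ∷ σ) = sgn σ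

actPt : ∀ {d} → Sigma d → Pt d → Pt d
actPt σ i = zipWith (λ b x → if b then ℤ.- x else x) σ i

act : ∀ {d} → Sigma d → LPoly d → LPoly d
act σ P = map (λ { (e , c) → (actPt σ e , c) }) P

zprod : ∀ d → LPoly d
zprod d = mono (replicate d 1ℤ)

sumG : ∀ {d} → (Sigma d → LPoly d) → LPoly d
sumG {d} f = concatMap f (allSigma d)

lhsCoeff : ∀ {d} → StepSet d → ℕ → LPoly d
lhsCoeff {d} S n =
  sumG (λ σ → scaleL (sgn σ) (act σ (zprod d) *L act σ (Fcoeff S n)))

-- [t^n] (Σ_σ sgn(σ) σ(z₁⋯z_d)) / (1 - t S(z))
--     = (Σ_σ sgn(σ) σ(z₁⋯z_d)) · S(z)^n,   since 1/(1-tS) = Σ_n S^n t^n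
rhsCoeff : ∀ {d} → StepSet d → ℕ → LPoly d
rhsCoeff {d} S n =
  sumG (λ σ → scaleL (sgn σ) (act σ (zprod d))) *L (stepPoly S ^L n)

module Submission where

-- Coefficients are read off by pairing Laurent polynomials with test functions φ : ℤ^d → ℚ.
-- Put Alt φ (q) = Σ_σ sgn σ · φ(σ q) and 𝟙 = (1,…,1). The right side pairs to Alt of the
-- count of all n-step words started at 𝟙, the left side to the count of orthant walks from
-- the origin weighted by Alt φ (𝟙 + ·). As S is G-invariant, Alt commutes with the step
-- operator f ↦ Σ_s f(· + s), and Alt f vanishes on the coordinate hyperplanes. A walk leaves
-- the orthant by a step from p ≥ 0 to a point with a coordinate -1, which the shift by 𝟙 puts
-- on a hyperplane; so, by induction on n, discarding such walks does not change the
-- alternating sum (the reflection principle).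

open import Defs
open import Function using (_∘_; mk⇔)
open import Algebra.Bundles using (CommutativeMonoid)
open import Data.Bool using (Bool; true; false; if_then_else_; _∧_)
open import Data.Nat using (ℕ; zero; suc; _≤_)
import Data.Integer as ℤ
open import Data.Integer using (0ℤ; 1ℤ; -1ℤ)
import Data.Integer.Properties as ℤ
open import Data.Rational using (ℚ; 0ℚ; 1ℚ; _+_; _*_; -_)
import Data.Rational.Properties as ℚ
import Data.Fin as Fin
open import Data.Vec using ([]; _∷_; replicate; lookup)
open import Data.Vec.Relation.Unary.Any using (Any; here; there)
open import Data.Vec.Relation.Binary.Pointwise.Inductive
  using (Pointwise-≡⇒≡; zipWith-assoc; zipWith-identityʳ)
open import Data.Vec.Properties using (≡-dec)
open import Data.List using (List; []; _∷_; map; concatMap; filterᵇ; foldr; _++_)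
open import Data.List.Properties using (map-cong; map-cong-local; map-∘)
open import Data.List.Membership.Propositional using (_∈_)
open import Data.List.Membership.Propositional.Properties using (∈-map⁺; ∈-map⁻)
open import Data.List.Membership.Propositional.Properties.WithK using (unique∧set⇒bag)
open import Data.List.Relation.Unary.All as All using ()
open import Data.List.Relation.Unary.Unique.Propositional using (Unique)
import Data.List.Relation.Unary.Unique.Propositional.Properties as Unique
open import Data.List.Relation.Binary.BagAndSetEquality using (∼bag⇒↭)
open import Data.List.Relation.Binary.Permutation.Propositional using (_↭_; ↭⇒↭ₛ)
import Data.List.Relation.Binary.Permutation.Propositional.Properties as ↭
open import Data.List.Relation.Binary.Permutation.Setoid.Properties using (foldr-commMonoid)
open import Data.Product using (_×_; _,_)
open import Data.Sum using (inj₁; inj₂; _⊎_)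
open import Relation.Nullary using (does)
open import Relation.Binary.PropositionalEquality
open ≡-Reasoning

private variable
  A B : Set

sumOver : List A → (A → ℚ) → ℚ
sumOver L f = foldr _+_ 0ℚ (map f L)

sumOver-cong : ∀ (L : List A) {f g : A → ℚ} → (∀ x → f x ≡ g x) → sumOver L f ≡ sumOver L g
sumOver-cong L f≗g = cong (foldr _+_ 0ℚ) (map-cong f≗g L)

sumOver-cong-∈ : ∀ (L : List A) {f g : A → ℚ} → (∀ {x} → x ∈ L → f x ≡ g x) →
                 sumOver L f ≡ sumOver L g
sumOver-cong-∈ L f≗g = cong (foldr _+_ 0ℚ) (map-cong-local (All.tabulate f≗g))

sumOver-map : ∀ (g : B → A) (L : List B) f → sumOver (map g L) f ≡ sumOver L (f ∘ g)
sumOver-map g L f = cong (foldr _+_ 0ℚ) (sym (map-∘ L))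

sumOver-++ : ∀ (L M : List A) f → sumOver (L ++ M) f ≡ sumOver L f + sumOver M f
sumOver-++ []      M f = sym (ℚ.+-identityˡ _)
sumOver-++ (x ∷ L) M f = trans (cong (f x +_) (sumOver-++ L M f)) (sym (ℚ.+-assoc (f x) _ _))

sumOver-concatMap : ∀ (g : B → List A) (L : List B) f →
                    sumOver (concatMap g L) f ≡ sumOver L (λ y → sumOver (g y) f)
sumOver-concatMap g []      f = refl
sumOver-concatMap g (y ∷ L) f =
  trans (sumOver-++ (g y) (concatMap g L) f) (cong (sumOver (g y) f +_) (sumOver-concatMap g L f))

sumOver-zero : ∀ (L : List A) → sumOver L (λ _ → 0ℚ) ≡ 0ℚ
sumOver-zero []      = refl
sumOver-zero (x ∷ L) = trans (ℚ.+-identityˡ _) (sumOver-zero L)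

sumOver-+ : ∀ (L : List A) f g → sumOver L (λ x → f x + g x) ≡ sumOver L f + sumOver L g
sumOver-+ []      f g = refl
sumOver-+ (x ∷ L) f g =
  trans (cong ((f x + g x) +_) (sumOver-+ L f g)) (interchange (f x) (g x) _ _)
  where open import Algebra.Properties.CommutativeSemigroup
          (CommutativeMonoid.commutativeSemigroup ℚ.+-0-commutativeMonoid) using (interchange)

sumOver-*ˡ : ∀ (L : List A) a f → a * sumOver L f ≡ sumOver L (λ x → a * f x)
sumOver-*ˡ []      a f = ℚ.*-zeroʳ a
sumOver-*ˡ (x ∷ L) a f = trans (ℚ.*-distribˡ-+ a (f x) _) (cong (a * f x +_) (sumOver-*ˡ L a f))

sumOver-neg : ∀ (L : List A) f → sumOver L (λ x → - f x) ≡ - sumOver L f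
sumOver-neg []      f = refl
sumOver-neg (x ∷ L) f = trans (cong (- f x +_) (sumOver-neg L f)) (sym (ℚ.neg-distrib-+ (f x) _))

sumOver-swap : ∀ (L : List A) (M : List B) (h : A → B → ℚ) →
               sumOver L (λ x → sumOver M (h x)) ≡ sumOver M (λ y → sumOver L (λ x → h x y))
sumOver-swap []      M h = sym (sumOver-zero M)
sumOver-swap (x ∷ L) M h =
  trans (cong (sumOver M (h x) +_) (sumOver-swap L M h)) (sym (sumOver-+ M (h x) _))

sumOver-filterᵇ : ∀ (p : A → Bool) (L : List A) f →
                  sumOver (filterᵇ p L) f ≡ sumOver L (λ x → if p x then f x else 0ℚ)
sumOver-filterᵇ p []      f = refl
sumOver-filterᵇ p (x ∷ L) f with p x
... | true  = cong (f x +_) (sumOver-filterᵇ p L f)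
... | false = trans (sumOver-filterᵇ p L f) (sym (ℚ.+-identityˡ _))

sumOver-involution : ∀ {L : List A} (g : A → A) → (∀ a → g (g a) ≡ a) → Unique L →
                     (∀ {x} → x ∈ L → g x ∈ L) → ∀ f → sumOver L (f ∘ g) ≡ sumOver L f
sumOver-involution {L = L} g g-involutive unique g-closed f =
  trans (cong (foldr _+_ 0ℚ) (map-∘ L))
    (foldr-commMonoid (setoid ℚ) ℚ.+-0-isCommutativeMonoid (↭⇒↭ₛ (↭.map⁺ f map-g-↭)))
  where
  g-injective : ∀ {x y} → g x ≡ g y → x ≡ y
  g-injective {x} {y} eq = trans (sym (g-involutive x)) (trans (cong g eq) (g-involutive y))
  to : ∀ {x} → x ∈ map g L → x ∈ L
  to x∈ with ∈-map⁻ g x∈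
  ... | _ , a∈ , refl = g-closed a∈
  from : ∀ {x} → x ∈ L → x ∈ map g L
  from {x} x∈ = subst (_∈ map g L) (g-involutive x) (∈-map⁺ g (g-closed x∈))
  map-g-↭ : map g L ↭ L
  map-g-↭ = ∼bag⇒↭ (unique∧set⇒bag (Unique.map⁺ g-injective unique) unique (mk⇔ to from))

ones : ∀ d → Pt d
ones d = replicate d 1ℤ

⊕-assoc : ∀ {d} (a b c : Pt d) → (a ⊕ b) ⊕ c ≡ a ⊕ (b ⊕ c)
⊕-assoc a b c = Pointwise-≡⇒≡ (zipWith-assoc ℤ.+-assoc a b c)

⊕-identityʳ : ∀ {d} (a : Pt d) → a ⊕ origin d ≡ a
⊕-identityʳ a = Pointwise-≡⇒≡ (zipWith-identityʳ ℤ.+-identityʳ a)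

actPt-⊕ : ∀ {d} (σ : Sigma d) (a b : Pt d) → actPt σ (a ⊕ b) ≡ actPt σ a ⊕ actPt σ b
actPt-⊕ []          []      []      = refl
actPt-⊕ (true ∷ σ)  (x ∷ a) (y ∷ b) = cong₂ _∷_ (ℤ.neg-distrib-+ x y) (actPt-⊕ σ a b)
actPt-⊕ (false ∷ σ) (x ∷ a) (y ∷ b) = cong (x ℤ.+ y ∷_) (actPt-⊕ σ a b)

actPt-involutive : ∀ {d} (σ : Sigma d) (a : Pt d) → actPt σ (actPt σ a) ≡ a
actPt-involutive []          []      = refl
actPt-involutive (true ∷ σ)  (x ∷ a) = cong₂ _∷_ (ℤ.neg-involutive x) (actPt-involutive σ a)
actPt-involutive (false ∷ σ) (x ∷ a) = cong (x ∷_) (actPt-involutive σ a)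

flipAt-closed⇒actPt-closed : ∀ {d} (P : Pt d → Set) → (∀ k {y} → P y → P (flipAt k y)) →
                             ∀ (σ : Sigma d) {y} → P y → P (actPt σ y)
flipAt-closed⇒actPt-closed P closed []      {[]}    Py = Py
flipAt-closed⇒actPt-closed P closed (b ∷ σ) {x ∷ y} Py = flip-head b
  where
  P-tail : P (x ∷ actPt σ y)
  P-tail = flipAt-closed⇒actPt-closed (λ z → P (x ∷ z)) (λ k → closed (Fin.suc k)) σ Py
  flip-head : ∀ b → P ((if b then ℤ.- x else x) ∷ actPt σ y)
  flip-head true  = closed Fin.zero P-tail
  flip-head false = P-tail

evalTerm : ∀ {d} → (Pt d → ℚ) → Pt d × ℚ → ℚ
evalTerm φ (e , c) = c * φ e

pair : ∀ {d} → LPoly d → (Pt d → ℚ) → ℚ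
pair P φ = sumOver P (evalTerm φ)

indicator : ∀ {d} → Pt d → Pt d → ℚ
indicator i e = if does (≡-dec ℤ._≟_ e i) then 1ℚ else 0ℚ

coeff≡pair-indicator : ∀ {d} (P : LPoly d) i → coeff P i ≡ pair P (indicator i)
coeff≡pair-indicator []            i = refl
coeff≡pair-indicator ((e , c) ∷ P) i =
  cong₂ _+_ (select (does (≡-dec ℤ._≟_ e i))) (coeff≡pair-indicator P i)
  where
  select : ∀ b → (if b then c else 0ℚ) ≡ c * (if b then 1ℚ else 0ℚ)
  select true  = sym (ℚ.*-identityʳ c)
  select false = sym (ℚ.*-zeroʳ c)

pair-cong : ∀ {d} (P : LPoly d) {φ ψ : Pt d → ℚ} → (∀ e → φ e ≡ ψ e) → pair P φ ≡ pair P ψ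
pair-cong P φ≗ψ = sumOver-cong P (λ { (e , c) → cong (c *_) (φ≗ψ e) })

pair-act : ∀ {d} (σ : Sigma d) (P : LPoly d) φ → pair (act σ P) φ ≡ pair P (φ ∘ actPt σ)
pair-act σ P φ = sumOver-map _ P (evalTerm φ)

pair-scaleL : ∀ {d} a (P : LPoly d) φ → pair (scaleL a P) φ ≡ a * pair P φ
pair-scaleL a P φ = begin
  sumOver (scaleL a P) (evalTerm φ)
    ≡⟨ sumOver-map _ P (evalTerm φ) ⟩
  sumOver P (λ { (e , c) → (a * c) * φ e })
    ≡⟨ sumOver-cong P (λ { (e , c) → ℚ.*-assoc a c (φ e) }) ⟩
  sumOver P (λ x → a * evalTerm φ x)
    ≡⟨ sumOver-*ˡ P a (evalTerm φ) ⟨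
  a * pair P φ ∎

pair-mono : ∀ {d} (e : Pt d) φ → pair (mono e) φ ≡ φ e
pair-mono e φ = trans (ℚ.+-identityʳ _) (ℚ.*-identityˡ _)

pair-*L : ∀ {d} (P Q : LPoly d) φ →
          pair (P *L Q) φ ≡ pair P (λ e → pair Q (λ e′ → φ (e ⊕ e′)))
pair-*L []            Q φ = refl
pair-*L ((e , c) ∷ P) Q φ =
  trans (sumOver-++ (map _ Q) (P *L Q) (evalTerm φ)) (cong₂ _+_ shifted (pair-*L P Q φ))
  where
  shifted : pair (map (λ { (e′ , c′) → (e ⊕ e′ , c * c′) }) Q) φ ≡
            c * pair Q (λ e′ → φ (e ⊕ e′))
  shifted = begin
    _                                      ≡⟨ sumOver-map _ Q (evalTerm φ) ⟩
    sumOver Q (λ { (e′ , c′) → (c * c′) * φ (e ⊕ e′) })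
      ≡⟨ sumOver-cong Q (λ { (e′ , c′) → ℚ.*-assoc c c′ (φ (e ⊕ e′)) }) ⟩
    sumOver Q (λ x → c * evalTerm (λ e′ → φ (e ⊕ e′)) x) ≡⟨ sumOver-*ˡ Q c _ ⟨
    c * pair Q (λ e′ → φ (e ⊕ e′))          ∎

pair-linear : ∀ {d} (L : List A) (c : A → ℚ) (P : LPoly d) (f : A → Pt d → ℚ) →
              sumOver L (λ a → c a * pair P (f a)) ≡ pair P (λ e → sumOver L (λ a → c a * f a e))
pair-linear {A = A} L c P f = begin
  sumOver L (λ a → c a * pair P (f a))
    ≡⟨ sumOver-cong L (λ a → sumOver-*ˡ P (c a) (evalTerm (f a))) ⟩
  sumOver L (λ a → sumOver P (λ t → c a * evalTerm (f a) t))
    ≡⟨ sumOver-swap L P _ ⟩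
  sumOver P (λ t → sumOver L (λ a → c a * evalTerm (f a) t))
    ≡⟨ sumOver-cong P (λ { (e , k) → pull-out k (λ a → f a e) }) ⟩
  pair P (λ e → sumOver L (λ a → c a * f a e)) ∎
  where
  pull-out : ∀ k (g : A → ℚ) →
             sumOver L (λ a → c a * (k * g a)) ≡ k * sumOver L (λ a → c a * g a)
  pull-out k g = trans (sumOver-cong L (λ a → x∙yz≈y∙xz (c a) k (g a))) (sym (sumOver-*ˡ L k _))
    where open import Algebra.Properties.CommutativeSemigroup
            (CommutativeMonoid.commutativeSemigroup ℚ.*-1-commutativeMonoid) using (x∙yz≈y∙xz)

walkSum : ∀ {d} → List (Pt d) → Pt d → ℕ → (Pt d → ℚ) → ℚ
walkSum S p zero    φ = φ p
walkSum S p (suc n) φ = sumOver S (λ s → walkSum S (p ⊕ s) n φ)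

orthantWalkSum : ∀ {d} → List (Pt d) → Pt d → ℕ → (Pt d → ℚ) → ℚ
orthantWalkSum S p n φ =
  sumOver (walksOfLength S n) (λ w → if staysFrom p w then φ (endFrom p w) else 0ℚ)

orthantWalkSum-zero : ∀ {d} (S : List (Pt d)) p φ → orthantWalkSum S p zero φ ≡ φ p
orthantWalkSum-zero S p φ = ℚ.+-identityʳ _

orthantWalkSum-suc : ∀ {d} (S : List (Pt d)) p n φ →
  orthantWalkSum S p (suc n) φ ≡
  sumOver S (λ s → if nonneg (p ⊕ s) then orthantWalkSum S (p ⊕ s) n φ else 0ℚ)
orthantWalkSum-suc S p n φ =
  trans (sumOver-concatMap (λ s → map (s ∷_) (walksOfLength S n)) S _)
    (sumOver-cong S (λ s → trans (sumOver-map (s ∷_) (walksOfLength S n) _)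
                                 (first-step s (nonneg (p ⊕ s)))))
  where
  first-step : ∀ s b →
    sumOver (walksOfLength S n)
            (λ w → if b ∧ staysFrom (p ⊕ s) w then φ (endFrom (p ⊕ s) w) else 0ℚ)
    ≡ (if b then orthantWalkSum S (p ⊕ s) n φ else 0ℚ)
  first-step s true  = refl
  first-step s false = sumOver-zero (walksOfLength S n)

pair-stepPoly^L : ∀ {d} (S : StepSet d) n (p : Pt d) φ →
                  pair (stepPoly S ^L n) (λ e → φ (p ⊕ e)) ≡ walkSum (steps S) p n φ
pair-stepPoly^L {d} S zero    p φ =
  trans (pair-mono (origin d) (λ e → φ (p ⊕ e))) (cong φ (⊕-identityʳ p))
pair-stepPoly^L     S (suc n) p φ = begin
  pair (stepPoly S *L (stepPoly S ^L n)) (λ e → φ (p ⊕ e))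
    ≡⟨ pair-*L (stepPoly S) (stepPoly S ^L n) _ ⟩
  pair (stepPoly S) (λ s → pair (stepPoly S ^L n) (λ e → φ (p ⊕ (s ⊕ e))))
    ≡⟨ sumOver-map _ (steps S) _ ⟩
  sumOver (steps S) (λ s → 1ℚ * pair (stepPoly S ^L n) (λ e → φ (p ⊕ (s ⊕ e))))
    ≡⟨ sumOver-cong (steps S) (λ s → ℚ.*-identityˡ _) ⟩
  sumOver (steps S) (λ s → pair (stepPoly S ^L n) (λ e → φ (p ⊕ (s ⊕ e))))
    ≡⟨ sumOver-cong (steps S) (λ s → pair-cong (stepPoly S ^L n) (λ e → cong φ (⊕-assoc p s e))) ⟨
  sumOver (steps S) (λ s → pair (stepPoly S ^L n) (λ e → φ ((p ⊕ s) ⊕ e)))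
    ≡⟨ sumOver-cong (steps S) (λ s → pair-stepPoly^L S n (p ⊕ s) φ) ⟩
  walkSum (steps S) p (suc n) φ ∎

nonneg-origin : ∀ d → nonneg (origin d) ≡ true
nonneg-origin zero    = refl
nonneg-origin (suc d) = nonneg-origin d

pair-Fcoeff : ∀ {d} (S : StepSet d) n φ → pair (Fcoeff S n) φ ≡ orthantWalkSum (steps S) (origin d) n φ
pair-Fcoeff {d} S n φ = begin
  pair (Fcoeff S n) φ
    ≡⟨ sumOver-map _ (filterᵇ inOrthant walks) (evalTerm φ) ⟩
  sumOver (filterᵇ inOrthant walks) (λ w → 1ℚ * φ (endFrom (origin d) w))
    ≡⟨ sumOver-filterᵇ inOrthant walks _ ⟩
  sumOver walks (λ w → if inOrthant w then 1ℚ * φ (endFrom (origin d) w) else 0ℚ)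
    ≡⟨ sumOver-cong walks (λ w → cong₂ (λ b x → if b ∧ staysFrom (origin d) w then x else 0ℚ)
                                       (nonneg-origin d) (ℚ.*-identityˡ _)) ⟩
  orthantWalkSum (steps S) (origin d) n φ ∎
  where
  walks = walksOfLength (steps S) n

alternate : ∀ {d} → (Pt d → ℚ) → Pt d → ℚ
alternate {d} f q = sumOver (allSigma d) (λ σ → sgn σ * f (actPt σ q))

alternate-∷ : ∀ {d} (f : Pt (suc d) → ℚ) x (xs : Pt d) →
  alternate f (x ∷ xs) ≡ - alternate (λ ys → f (ℤ.- x ∷ ys)) xs + alternate (λ ys → f (x ∷ ys)) xs
alternate-∷ {d} f x xs = begin
  alternate f (x ∷ xs)
    ≡⟨ sumOver-concatMap (λ b → map (b ∷_) G) (true ∷ false ∷ []) term ⟩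
  sumOver (map (true ∷_) G) term + (sumOver (map (false ∷_) G) term + 0ℚ)
    ≡⟨ cong₂ _+_ (trans (sumOver-map _ G term) negated)
                 (trans (ℚ.+-identityʳ _) (sumOver-map _ G term)) ⟩
  - alternate (λ ys → f (ℤ.- x ∷ ys)) xs + alternate (λ ys → f (x ∷ ys)) xs ∎
  where
  G : List (Sigma d)
  G = allSigma d
  term : Sigma (suc d) → ℚ
  term σ = sgn σ * f (actPt σ (x ∷ xs))
  negated : sumOver G (λ σ → (- sgn σ) * f (ℤ.- x ∷ actPt σ xs)) ≡
            - alternate (λ ys → f (ℤ.- x ∷ ys)) xs
  negated = trans (sumOver-cong G (λ σ → sym (ℚ.neg-distribˡ-* (sgn σ) _))) (sumOver-neg G _)

-- The reflection in a hyperplane {x_k = 0} fixes the point and flips the sign.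
alternate-vanishes : ∀ {d} {q : Pt d} → Any (_≡ 0ℤ) q → ∀ f → alternate f q ≡ 0ℚ
alternate-vanishes {q = x ∷ xs} (here refl) f =
  trans (alternate-∷ f 0ℤ xs) (ℚ.+-inverseˡ (alternate (λ ys → f (0ℤ ∷ ys)) xs))
alternate-vanishes {q = x ∷ xs} (there h)   f = begin
  alternate f (x ∷ xs)
    ≡⟨ alternate-∷ f x xs ⟩
  - alternate (λ ys → f (ℤ.- x ∷ ys)) xs + alternate (λ ys → f (x ∷ ys)) xs
    ≡⟨ cong₂ (λ a b → - a + b) (alternate-vanishes h (λ ys → f (ℤ.- x ∷ ys)))
                                (alternate-vanishes h (λ ys → f (x ∷ ys))) ⟩
  - 0ℚ + 0ℚ
    ≡⟨ ℚ.+-inverseˡ 0ℚ ⟩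
  0ℚ ∎

alternate-stepSum : ∀ {d} {S : List (Pt d)} → Unique S → (∀ σ {s} → s ∈ S → actPt σ s ∈ S) →
  ∀ (h : Pt d → ℚ) q →
  alternate (λ r → sumOver S (λ s → h (r ⊕ s))) q ≡ sumOver S (λ s → alternate h (q ⊕ s))
alternate-stepSum {d} {S} unique closed h q = begin
  sumOver G (λ σ → sgn σ * sumOver S (λ s → h (actPt σ q ⊕ s)))
    ≡⟨ sumOver-cong G (λ σ → cong (sgn σ *_) (equivariant σ)) ⟩
  sumOver G (λ σ → sgn σ * sumOver S (λ s → h (actPt σ (q ⊕ s))))
    ≡⟨ sumOver-cong G (λ σ → sumOver-*ˡ S (sgn σ) _) ⟩
  sumOver G (λ σ → sumOver S (λ s → sgn σ * h (actPt σ (q ⊕ s))))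
    ≡⟨ sumOver-swap G S _ ⟩
  sumOver S (λ s → alternate h (q ⊕ s)) ∎
  where
  G : List (Sigma d)
  G = allSigma d
  equivariant : ∀ σ →
                sumOver S (λ s → h (actPt σ q ⊕ s)) ≡ sumOver S (λ s → h (actPt σ (q ⊕ s)))
  equivariant σ = begin
    sumOver S (λ s → h (actPt σ q ⊕ s))
      ≡⟨ sumOver-involution (actPt σ) (actPt-involutive σ) unique (closed σ) _ ⟨
    sumOver S (λ s → h (actPt σ q ⊕ actPt σ s))
      ≡⟨ sumOver-cong S (λ s → cong h (sym (actPt-⊕ σ q s))) ⟩
    sumOver S (λ s → h (actPt σ (q ⊕ s))) ∎

exit-hits-wall : ∀ {d} (p s : Pt d) → nonneg p ≡ true →
  (∀ k → (lookup s k ≡ -1ℤ) ⊎ (lookup s k ≡ 0ℤ) ⊎ (lookup s k ≡ 1ℤ)) →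
  nonneg (p ⊕ s) ≡ false → Any (_≡ 0ℤ) (ones d ⊕ (p ⊕ s))
exit-hits-wall []                []      _   _     ()
exit-hits-wall (ℤ.-[1+ _ ] ∷ p) (y ∷ s) ()  _     _
exit-hits-wall (ℤ.+ m ∷ p)      (y ∷ s) p≥0 small exits with small Fin.zero
exit-hits-wall (ℤ.+ zero ∷ p)   (y ∷ s) p≥0 small exits | inj₁ refl = here refl
exit-hits-wall (ℤ.+ suc m ∷ p)  (y ∷ s) p≥0 small exits | inj₁ refl =
  there (exit-hits-wall p s p≥0 (small ∘ Fin.suc) exits)
... | inj₂ (inj₁ refl) = there (exit-hits-wall p s p≥0 (small ∘ Fin.suc) exits)
... | inj₂ (inj₂ refl) = there (exit-hits-wall p s p≥0 (small ∘ Fin.suc) exits)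

AxisSymmetric⇒actPt-closed : ∀ {d} (S : StepSet d) → AxisSymmetric S →
                             ∀ σ {s} → s ∈ steps S → actPt σ s ∈ steps S
AxisSymmetric⇒actPt-closed S symmetric =
  flipAt-closed⇒actPt-closed (_∈ steps S) (λ k s∈ → symmetric s∈ k)

reflection-principle : ∀ {d} (S : StepSet d) → AxisSymmetric S → ∀ (φ : Pt d → ℚ) n p →
  nonneg p ≡ true →
  alternate (λ q → walkSum (steps S) q n φ) (ones d ⊕ p) ≡
  orthantWalkSum (steps S) p n (λ e → alternate φ (ones d ⊕ e))
reflection-principle {d} S symmetric φ zero    p _   =
  sym (orthantWalkSum-zero (steps S) p (λ e → alternate φ (ones d ⊕ e)))
reflection-principle {d} S symmetric φ (suc n) p p≥0 = begin
  alternate (λ q → walkSum (steps S) q (suc n) φ) (ones d ⊕ p)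
    ≡⟨ alternate-stepSum (unique S) (AxisSymmetric⇒actPt-closed S symmetric) W (ones d ⊕ p) ⟩
  sumOver (steps S) (λ s → alternate W ((ones d ⊕ p) ⊕ s))
    ≡⟨ sumOver-cong (steps S) (λ s → cong (alternate W) (⊕-assoc (ones d) p s)) ⟩
  sumOver (steps S) (λ s → alternate W (ones d ⊕ (p ⊕ s)))
    ≡⟨ sumOver-cong-∈ (steps S) (λ s∈ → first-step s∈ (nonneg (p ⊕ _)) refl) ⟩
  sumOver (steps S) (λ s → if nonneg (p ⊕ s) then orthantWalkSum (steps S) (p ⊕ s) n g else 0ℚ)
    ≡⟨ orthantWalkSum-suc (steps S) p n g ⟨
  orthantWalkSum (steps S) p (suc n) g ∎
  where
  W g : Pt d → ℚ
  W q = walkSum (steps S) q n φ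
  g e = alternate φ (ones d ⊕ e)
  first-step : ∀ {s} → s ∈ steps S → ∀ b → nonneg (p ⊕ s) ≡ b →
    alternate W (ones d ⊕ (p ⊕ s)) ≡ (if b then orthantWalkSum (steps S) (p ⊕ s) n g else 0ℚ)
  first-step s∈ true  stays = reflection-principle S symmetric φ n _ stays
  first-step s∈ false exits = alternate-vanishes (exit-hits-wall p _ p≥0 (entries S s∈) exits) W

pair-act-zprod : ∀ {d} (σ : Sigma d) φ → pair (act σ (zprod d)) φ ≡ φ (actPt σ (ones d))
pair-act-zprod {d} σ φ = trans (pair-act σ (zprod d) φ) (pair-mono (ones d) (φ ∘ actPt σ))

pair-sumG-sgn : ∀ {d} (P : Sigma d → LPoly d) φ →
  pair (sumG (λ σ → scaleL (sgn σ) (P σ))) φ ≡ sumOver (allSigma d) (λ σ → sgn σ * pair (P σ) φ)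
pair-sumG-sgn {d} P φ =
  trans (sumOver-concatMap _ (allSigma d) (evalTerm φ))
        (sumOver-cong (allSigma d) (λ σ → pair-scaleL (sgn σ) (P σ) φ))

pair-alternating-zprod : ∀ {d} φ →
  pair (sumG (λ σ → scaleL (sgn σ) (act σ (zprod d)))) φ ≡ alternate φ (ones d)
pair-alternating-zprod {d} φ =
  trans (pair-sumG-sgn (λ σ → act σ (zprod d)) φ)
        (sumOver-cong (allSigma d) (λ σ → cong (sgn σ *_) (pair-act-zprod σ φ)))

pair-lhsCoeff : ∀ {d} (S : StepSet d) n φ →
  pair (lhsCoeff S n) φ ≡ pair (Fcoeff S n) (λ e → alternate φ (ones d ⊕ e))
pair-lhsCoeff {d} S n φ = begin
  pair (lhsCoeff S n) φ
    ≡⟨ pair-sumG-sgn (λ σ → act σ (zprod d) *L act σ F) φ ⟩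
  sumOver (allSigma d) (λ σ → sgn σ * pair (act σ (zprod d) *L act σ F) φ)
    ≡⟨ sumOver-cong (allSigma d) (λ σ → cong (sgn σ *_) (σ-term σ)) ⟩
  sumOver (allSigma d) (λ σ → sgn σ * pair F (λ e → φ (actPt σ (ones d ⊕ e))))
    ≡⟨ pair-linear (allSigma d) sgn F (λ σ e → φ (actPt σ (ones d ⊕ e))) ⟩
  pair F (λ e → alternate φ (ones d ⊕ e)) ∎
  where
  F : LPoly d
  F = Fcoeff S n
  σ-term : ∀ σ → pair (act σ (zprod d) *L act σ F) φ ≡ pair F (λ e → φ (actPt σ (ones d ⊕ e)))
  σ-term σ = begin
    pair (act σ (zprod d) *L act σ F) φ
      ≡⟨ pair-*L (act σ (zprod d)) (act σ F) φ ⟩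
    pair (act σ (zprod d)) (λ e → pair (act σ F) (λ e′ → φ (e ⊕ e′)))
      ≡⟨ pair-act-zprod σ (λ e → pair (act σ F) (λ e′ → φ (e ⊕ e′))) ⟩
    pair (act σ F) (λ e′ → φ (actPt σ (ones d) ⊕ e′))
      ≡⟨ pair-act σ F _ ⟩
    pair F (λ e → φ (actPt σ (ones d) ⊕ actPt σ e))
      ≡⟨ pair-cong F (λ e → cong φ (actPt-⊕ σ (ones d) e)) ⟨
    pair F (λ e → φ (actPt σ (ones d ⊕ e))) ∎

pair-rhsCoeff : ∀ {d} (S : StepSet d) n φ →
  pair (rhsCoeff S n) φ ≡ alternate (λ q → walkSum (steps S) q n φ) (ones d)
pair-rhsCoeff {d} S n φ = begin
  pair (rhsCoeff S n) φ
    ≡⟨ pair-*L Z (stepPoly S ^L n) φ ⟩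
  pair Z (λ e → pair (stepPoly S ^L n) (λ e′ → φ (e ⊕ e′)))
    ≡⟨ pair-cong Z (λ e → pair-stepPoly^L S n e φ) ⟩
  pair Z (λ q → walkSum (steps S) q n φ)
    ≡⟨ pair-alternating-zprod (λ q → walkSum (steps S) q n φ) ⟩
  alternate (λ q → walkSum (steps S) q n φ) (ones d) ∎
  where
  Z : LPoly d
  Z = sumG (λ σ → scaleL (sgn σ) (act σ (zprod d)))

lemma2p2 : (d : ℕ) → 1 ≤ d → (S : StepSet d) →
    AxisSymmetric S → PositiveInEveryDirection S →
    ∀ (n : ℕ) → lhsCoeff S n ≈L rhsCoeff S n
lemma2p2 d _ S symmetric _ n i = begin
  coeff (lhsCoeff S n) i
    ≡⟨ coeff≡pair-indicator (lhsCoeff S n) i ⟩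
  pair (lhsCoeff S n) δ
    ≡⟨ pair-lhsCoeff S n δ ⟩
  pair (Fcoeff S n) (λ e → alternate δ (ones d ⊕ e))
    ≡⟨ pair-Fcoeff S n _ ⟩
  orthantWalkSum (steps S) (origin d) n (λ e → alternate δ (ones d ⊕ e))
    ≡⟨ reflection-principle S symmetric δ n (origin d) (nonneg-origin d) ⟨
  alternate W (ones d ⊕ origin d)
    ≡⟨ cong (alternate W) (⊕-identityʳ (ones d)) ⟩
  alternate W (ones d)
    ≡⟨ pair-rhsCoeff S n δ ⟨
  pair (rhsCoeff S n) δ
    ≡⟨ coeff≡pair-indicator (rhsCoeff S n) i ⟨
  coeff (rhsCoeff S n) i ∎
  where
  δ : Pt d → ℚ
  δ = indicator i
  W : Pt d → ℚ
  W q = walkSum (steps S) q n δ
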